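{- For $n\ge1$, the approximating multigraph $G_n$ of the non-p.c.f. analog of the Sierpiński gasket, with vertex degrees $d_1,\dots,d_{|V_n|}$, satisfies $$\frac{\prod_{j=1}^{|V_n|}d_j}{\sum_{j=1}^{|V_n|}d_j}=2^{\frac1{25}(44\cdot6^n+30n+6)}\cdot3^{\frac15(6^n-5n-6)}.$$
   Context: $G_0$ is a single triangle (3-cycle). $G_n$ is obtained from $G_{n-1}$ by replacing each triangle with vertices $a,b,c$ by six triangles, using four new vertices $m_{ab},m_{bc},m_{ca},o$ (distinct for distinct triangles): $\{a,m_{ab},o\},\{m_{ab},b,o\},\{b,m_{bc},o\},\{m_{bc},c,o\},\{c,m_{ca},o\},\{m_{ca},a,o\}$. The edge multiset of $G_n$ is the multiset union of the three edges of each triangle; degrees count edges with multiplicity; $V_n$ is the vertex set of $G_n$. -}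

module Defs where

open import Data.Nat as ℕ using (ℕ; zero; suc; _+_; _*_; _≡ᵇ_)
open import Data.Nat.Properties using (m^n≢0)
open import Data.Bool using (Bool; true; false; _∨_; if_then_else_)
open import Data.List using (List; []; _∷_; _++_; foldr; map; upTo; concatMap)
open import Data.Nat.ListAction using (sum; product)
open import Data.Product using (_×_; _,_; proj₁; proj₂)
open import Data.Integer using (ℤ; +_; -[1+_])
open import Data.Rational using (ℚ; _/_)

Tri : Set
Tri = ℕ × ℕ × ℕ

-- Subdivide every triangle of the list; k is the next fresh vertex label.  Each triangle {a,b,c}
-- receives its own four new vertices m_ab = k, m_bc = k+1, m_ca = k+2, o = k+3.
refine : ℕ → List Tri → ℕ × List Tri
refine k [] = k , []
refine k ((a , b , c) ∷ ts) with refine (k + 4) ts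
... | k' , ts' =
  k' , ( (a , mab , o) ∷ (mab , b , o) ∷ (b , mbc , o) ∷ (mbc , c , o)
       ∷ (c , mca , o) ∷ (mca , a , o) ∷ ts')
  where
  mab = k
  mbc = k + 1
  mca = k + 2
  o   = k + 3

-- G n = (number of vertices |V_n|, list of triangles of G_n).
-- The vertex set V_n is {0, …, |V_n| - 1}.
G : ℕ → ℕ × List Tri
G zero = 3 , ((0 , 1 , 2) ∷ [])
G (suc n) = refine (proj₁ (G n)) (proj₂ (G n))

numVertices : ℕ → ℕ
numVertices n = proj₁ (G n)

vertices : ℕ → List ℕ
vertices n = upTo (numVertices n)

edges : ℕ → List (ℕ × ℕ)
edges n = concatMap (λ { (a , b , c) → (a , b) ∷ (b , c) ∷ (c , a) ∷ [] }) (proj₂ (G n))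

degree : ℕ → ℕ → ℕ
degree n v = foldr (λ { (x , y) acc → if (v ≡ᵇ x) ∨ (v ≡ᵇ y) then suc acc else acc }) 0 (edges n)

pow2ℤ : ℤ → ℚ
pow2ℤ (+ k) = (+ (2 ℕ.^ k)) / 1
pow2ℤ -[1+ k ] = _/_ (+ 1) (2 ℕ.^ suc k) {{m^n≢0 2 (suc k)}}

pow3ℤ : ℤ → ℚ
pow3ℤ (+ k) = (+ (3 ℕ.^ k)) / 1
pow3ℤ -[1+ k ] = _/_ (+ 1) (3 ℕ.^ suc k) {{m^n≢0 3 (suc k)}}

degProduct : ℕ → ℕ
degProduct n = product (map (degree n) (vertices n))

degSum : ℕ → ℕ
degSum n = sum (map (degree n) (vertices n))

module Submission where

-- Regroup the edge multiset by triangles: the degree of v is the sum over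
-- the triangles t of the number of edges of t at v.  One subdivision step,
-- applied to a triangle list whose corners are distinct labels below the
-- first fresh label k, then
--   * doubles the degree of every old vertex (each corner lies in exactly
--     two of the six new triangles, each contributing two edges), and
--   * gives the four new vertices of every triangle degrees 4, 4, 4, 12
--     (three edge midpoints and the centre).
-- Hence the degree sequence of G (n+1) is twice that of G n followed by
-- 6ⁿ blocks 4 4 4 12.  This yields recurrences for the product P n and the
-- sum S n of the degrees, which are solved in closed form:
--   S n = 6ⁿ⁺¹  and  3 · P n = S n · 2^(twoExp n) · 3^(threeExp n),
-- with 25 · twoExp n = 44·6ⁿ + 30n + 6 and 5 · threeExp n = 6ⁿ − 5n − 1.
-- The theorem takes e₂ = twoExp n and e₃ = threeExp n − 1; for n = 1 the
-- exponent e₃ = −1 is negative and the identity is checked by evaluation.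

open import Defs
open import Data.Nat using (ℕ; zero; suc; pred; _+_; _*_; _^_; _≡ᵇ_; _<ᵇ_; _<_; _≤_; _≥_; _≟_; s≤s; z≤n)
open import Data.Nat.Properties
open import Data.Nat.ListAction using (sum; product)
open import Data.Nat.ListAction.Properties using (sum-++; product-++)
import Data.Nat.Tactic.RingSolver as ℕ-Ring
open import Data.Nat.Coprimality using (Coprime; 1-coprimeTo)
import Data.Nat.Coprimality as Coprimality
open import Data.Integer using (ℤ; +_; _-_)
import Data.Integer as ℤ
open import Data.Integer.Properties using (pos-+; pos-*)
import Data.Integer.Tactic.RingSolver as ℤ-Ring
open import Data.Rational using (ℚ; _/_)
import Data.Rational as ℚ
open import Data.Rational.Properties using (normalize-coprime)
open import Data.Bool using (Bool; true; false; T; _∨_; if_then_else_)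
open import Data.List using (List; []; _∷_; _++_; foldr; map; concat; concatMap; replicate; applyUpTo; length)
open import Data.List.Properties using (map-++; map-upTo; map-applyUpTo; length-applyUpTo)
open import Data.List.Relation.Unary.All using (All; []; _∷_)
import Data.List.Relation.Unary.All as All
open import Data.List.Relation.Unary.All.Properties using (++⁺)
open import Data.Product using (Σ; _×_; _,_; proj₁; proj₂)
open import Data.Empty using (⊥; ⊥-elim)
open import Relation.Nullary.Decidable using (dec-false)
open import Relation.Binary.PropositionalEquality
open ≡-Reasoning

indicator : Bool → ℕ
indicator true  = 1
indicator false = 0

cornerDeg : Bool → Bool → Bool → ℕ
cornerDeg x y z = indicator (x ∨ y) + indicator (y ∨ z) + indicator (z ∨ x)

triDeg : ℕ → Tri → ℕ
triDeg v (a , b , c) = cornerDeg (v ≡ᵇ a) (v ≡ᵇ b) (v ≡ᵇ c)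

deg : ℕ → List Tri → ℕ
deg v ts = sum (map (triDeg v) ts)

deg-++ : ∀ v xs ys → deg v (xs ++ ys) ≡ deg v xs + deg v ys
deg-++ v xs ys = trans (cong sum (map-++ (triDeg v) xs ys)) (sum-++ (map (triDeg v) xs) (map (triDeg v) ys))

if-suc : ∀ b n → (if b then suc n else n) ≡ indicator b + n
if-suc true  n = refl
if-suc false n = refl

-- The step function and the edge
-- list of a triangle are abstracted so that the anonymous functions used
-- in the definition of `degree` can be plugged in.
module EdgeCount (v : ℕ) (step : ℕ × ℕ → ℕ → ℕ) (edgesOf : Tri → List (ℕ × ℕ))
  (step-def : ∀ x y n → step (x , y) n ≡ (if (v ≡ᵇ x) ∨ (v ≡ᵇ y) then suc n else n))
  (edgesOf-def : ∀ a b c → edgesOf (a , b , c) ≡ (a , b) ∷ (b , c) ∷ (c , a) ∷ []) where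

  count : ℕ × ℕ → ℕ
  count (x , y) = indicator ((v ≡ᵇ x) ∨ (v ≡ᵇ y))

  step-count : ∀ e n → step e n ≡ count e + n
  step-count (x , y) n = trans (step-def x y n) (if-suc _ n)

  foldr-edges : ∀ ts → foldr step 0 (concatMap edgesOf ts) ≡ deg v ts
  foldr-edges [] = refl
  foldr-edges ((a , b , c) ∷ ts) rewrite edgesOf-def a b c = begin
    step (a , b) (step (b , c) (step (c , a) rest))
      ≡⟨ step-count (a , b) _ ⟩
    count (a , b) + step (b , c) (step (c , a) rest)
      ≡⟨ cong (λ m → count (a , b) + m) (step-count (b , c) _) ⟩
    count (a , b) + (count (b , c) + step (c , a) rest)
      ≡⟨ cong (λ m → count (a , b) + (count (b , c) + m)) (step-count (c , a) rest) ⟩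
    count (a , b) + (count (b , c) + (count (c , a) + rest))
      ≡⟨ cong (λ m → count (a , b) + (count (b , c) + (count (c , a) + m))) (foldr-edges ts) ⟩
    count (a , b) + (count (b , c) + (count (c , a) + deg v ts))
      ≡⟨ regroup (count (a , b)) (count (b , c)) (count (c , a)) (deg v ts) ⟩
    deg v ((a , b , c) ∷ ts) ∎
    where
    rest : ℕ
    rest = foldr step 0 (concatMap edgesOf ts)
    regroup : ∀ x y z r → x + (y + (z + r)) ≡ x + y + z + r
    regroup = ℕ-Ring.solve-∀

tris : ℕ → List Tri
tris n = proj₂ (G n)

degree≡deg : ∀ n v → degree n v ≡ deg v (tris n)
degree≡deg n v = EdgeCount.foldr-edges v _ _ (λ _ _ _ → refl) (λ _ _ _ → refl) (tris n)

-- The six triangles replacing (a, b, c); the new vertices are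
-- k, k + 1, k + 2 (midpoints of ab, bc, ca) and k + 3 (centre).
subdivide : ℕ → Tri → List Tri
subdivide k (a , b , c) =
  (a , k , k + 3) ∷ (k , b , k + 3) ∷ (b , k + 1 , k + 3) ∷ (k + 1 , c , k + 3)
  ∷ (c , k + 2 , k + 3) ∷ (k + 2 , a , k + 3) ∷ []

-- The triangles of a refinement; by definition of `refine`,
-- refined k ((a , b , c) ∷ ts) unfolds to subdivide k (a , b , c) ++ refined (k + 4) ts.
refined : ℕ → List Tri → List Tri
refined k ts = proj₂ (refine k ts)

refine-next : ∀ k ts → proj₁ (refine k ts) ≡ k + length ts * 4
refine-next k [] = sym (+-identityʳ k)
refine-next k (t ∷ ts) = trans (refine-next (k + 4) ts) (+-assoc k 4 (length ts * 4))

refine-length : ∀ k ts → length (refined k ts) ≡ length ts * 6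
refine-length k [] = refl
refine-length k ((a , b , c) ∷ ts) = cong (λ m → 6 + m) (refine-length (k + 4) ts)

-- The degree of v in the six triangles as a function of which of the
-- seven vertices a b c, m₁ m₂ m₃ (midpoints), o (centre) it equals.
subdivDeg : (a b c m₁ m₂ m₃ o : Bool) → ℕ
subdivDeg a b c m₁ m₂ m₃ o =
  cornerDeg a m₁ o + (cornerDeg m₁ b o + (cornerDeg b m₂ o + (cornerDeg m₂ c o
  + (cornerDeg c m₃ o + (cornerDeg m₃ a o + 0)))))

subdivide-deg : ∀ {xa xb xc m₁ m₂ m₃ o} v k a b c →
  (v ≡ᵇ a) ≡ xa → (v ≡ᵇ b) ≡ xb → (v ≡ᵇ c) ≡ xc →
  (v ≡ᵇ k) ≡ m₁ → (v ≡ᵇ k + 1) ≡ m₂ → (v ≡ᵇ k + 2) ≡ m₃ → (v ≡ᵇ k + 3) ≡ o →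
  deg v (subdivide k (a , b , c)) ≡ subdivDeg xa xb xc m₁ m₂ m₃ o
subdivide-deg v k a b c refl refl refl refl refl refl refl = refl

≢⇒≡ᵇ-false : ∀ {m n} → m ≢ n → (m ≡ᵇ n) ≡ false
≢⇒≡ᵇ-false {m} {n} = dec-false (m ≟ n)

beyond⇒≡ᵇ-false : ∀ {x N v} → x < N → N ≤ v → (v ≡ᵇ x) ≡ false
beyond⇒≡ᵇ-false x<N N≤v = ≢⇒≡ᵇ-false (>⇒≢ (<-≤-trans x<N N≤v))

+-≡ᵇ-cancelˡ : ∀ k i j → (k + i ≡ᵇ k + j) ≡ (i ≡ᵇ j)
+-≡ᵇ-cancelˡ zero    i j = refl
+-≡ᵇ-cancelˡ (suc k) i j = +-≡ᵇ-cancelˡ k i j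

+-≡ᵇ-self : ∀ k i → (k + i ≡ᵇ k) ≡ (i ≡ᵇ 0)
+-≡ᵇ-self zero    i = refl
+-≡ᵇ-self (suc k) i = +-≡ᵇ-self k i

corner-doubling : ∀ x y z → (T x → T y → ⊥) → (T y → T z → ⊥) → (T z → T x → ⊥) →
  subdivDeg x y z false false false false ≡ 2 * cornerDeg x y z
corner-doubling false false false _ _ _ = refl
corner-doubling true  false false _ _ _ = refl
corner-doubling false true  false _ _ _ = refl
corner-doubling false false true  _ _ _ = refl
corner-doubling true  true  _     h _ _ = ⊥-elim (h _ _)
corner-doubling _     true  true  _ h _ = ⊥-elim (h _ _)
corner-doubling true  _     true  _ _ h = ⊥-elim (h _ _)

-- Degrees of the vertices k + i when no corner is ≥ k.
newVertexDeg : ℕ → ℕ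
newVertexDeg 0 = 4
newVertexDeg 1 = 4
newVertexDeg 2 = 4
newVertexDeg 3 = 12
newVertexDeg _ = 0

fresh-pattern : ∀ i → subdivDeg false false false (i ≡ᵇ 0) (i ≡ᵇ 1) (i ≡ᵇ 2) (i ≡ᵇ 3) ≡ newVertexDeg i
fresh-pattern 0 = refl
fresh-pattern 1 = refl
fresh-pattern 2 = refl
fresh-pattern 3 = refl
fresh-pattern (suc (suc (suc (suc i)))) = refl

CornersBelow : ℕ → Tri → Set
CornersBelow N (a , b , c) = a < N × b < N × c < N

Distinct : Tri → Set
Distinct (a , b , c) = a ≢ b × b ≢ c × c ≢ a

-- A vertex below k is not new and is a corner at most once, so its degree doubles.
subdivide-deg-old : ∀ {v k a b c} → v < k → Distinct (a , b , c) →
  deg v (subdivide k (a , b , c)) ≡ 2 * triDeg v (a , b , c)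
subdivide-deg-old {v} {k} {a} {b} {c} v<k (a≢b , b≢c , c≢a) =
  trans (subdivide-deg v k a b c refl refl refl (≢⇒≡ᵇ-false (<⇒≢ v<k)) (new 1) (new 2) (new 3))
        (corner-doubling _ _ _ (notBoth a≢b) (notBoth b≢c) (notBoth c≢a))
  where
  new : ∀ j → (v ≡ᵇ k + j) ≡ false
  new j = ≢⇒≡ᵇ-false (<⇒≢ (<-≤-trans v<k (m≤m+n k j)))
  notBoth : ∀ {x y} → x ≢ y → T (v ≡ᵇ x) → T (v ≡ᵇ y) → ⊥
  notBoth {x} {y} x≢y p q = x≢y (trans (sym (≡ᵇ⇒≡ v x p)) (≡ᵇ⇒≡ v y q))

-- The vertex k + i: the i-th new vertex (i < 4) or not a vertex at all (i ≥ 4).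
subdivide-deg-fresh : ∀ {k a b c} → CornersBelow k (a , b , c) → ∀ i →
  deg (k + i) (subdivide k (a , b , c)) ≡ newVertexDeg i
subdivide-deg-fresh {k} {a} {b} {c} (a<k , b<k , c<k) i =
  trans (subdivide-deg (k + i) k a b c (old a<k) (old b<k) (old c<k)
           (+-≡ᵇ-self k i) (+-≡ᵇ-cancelˡ k i 1) (+-≡ᵇ-cancelˡ k i 2) (+-≡ᵇ-cancelˡ k i 3))
        (fresh-pattern i)
  where
  old : ∀ {x} → x < k → (k + i ≡ᵇ x) ≡ false
  old x<k = beyond⇒≡ᵇ-false x<k (m≤m+n k i)

module SubdivisionShape {k a b c : ℕ} (below : CornersBelow k (a , b , c)) where

  corner≢new : ∀ {x} → x < k → ∀ j → x ≢ k + j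
  corner≢new x<k j = <⇒≢ (<-≤-trans x<k (m≤m+n k j))

  new≢new : ∀ i j → i ≢ j → k + i ≢ k + j
  new≢new i j i≢j eq = i≢j (+-cancelˡ-≡ k i j eq)

  k≢new : ∀ j → k ≢ k + suc j
  k≢new j = <⇒≢ (m<m+n k (s≤s z≤n))

  distinct : All Distinct (subdivide k (a , b , c))
  distinct =
      (<⇒≢ a<k , k≢new 2 , ≢-sym (corner≢new a<k 3))
    ∷ (≢-sym (<⇒≢ b<k) , corner≢new b<k 3 , ≢-sym (k≢new 2))
    ∷ (corner≢new b<k 1 , new≢new 1 3 (λ ()) , ≢-sym (corner≢new b<k 3))
    ∷ (≢-sym (corner≢new c<k 1) , corner≢new c<k 3 , new≢new 3 1 (λ ()))
    ∷ (corner≢new c<k 2 , new≢new 2 3 (λ ()) , ≢-sym (corner≢new c<k 3))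
    ∷ (≢-sym (corner≢new a<k 2) , corner≢new a<k 3 , new≢new 3 2 (λ ()))
    ∷ []
    where
    a<k : a < k
    a<k = proj₁ below
    b<k : b < k
    b<k = proj₁ (proj₂ below)
    c<k : c < k
    c<k = proj₂ (proj₂ below)

  bounded : All (CornersBelow (k + 4)) (subdivide k (a , b , c))
  bounded =
      (a' , k<k+4 , new 3) ∷ (k<k+4 , b' , new 3) ∷ (b' , new 1 , new 3)
    ∷ (new 1 , c' , new 3) ∷ (c' , new 2 , new 3) ∷ (new 2 , a' , new 3) ∷ []
    where
    old : ∀ {x} → x < k → x < k + 4
    old x<k = <-≤-trans x<k (m≤m+n k 4)
    a' : a < k + 4
    a' = old (proj₁ below)
    b' : b < k + 4
    b' = old (proj₁ (proj₂ below))
    c' : c < k + 4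
    c' = old (proj₂ (proj₂ below))
    k<k+4 : k < k + 4
    k<k+4 = m<m+n k (s≤s z≤n)
    new : ∀ j {j<4 : T (j <ᵇ 4)} → k + j < k + 4
    new j {j<4} = +-monoʳ-< k (<ᵇ⇒< j 4 j<4)

below-mono : ∀ {N M} → N ≤ M → ∀ t → CornersBelow N t → CornersBelow M t
below-mono N≤M (a , b , c) (a<N , b<N , c<N) =
  <-≤-trans a<N N≤M , <-≤-trans b<N N≤M , <-≤-trans c<N N≤M

refine-next-≥ : ∀ k ts → k ≤ proj₁ (refine k ts)
refine-next-≥ k ts = subst (k ≤_) (sym (refine-next k ts)) (m≤m+n k (length ts * 4))

refine-bounded : ∀ {N} k ts → All (CornersBelow N) ts → N ≤ k →
  All (CornersBelow (proj₁ (refine k ts))) (refined k ts)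
refine-bounded k [] [] _ = []
refine-bounded k ((a , b , c) ∷ ts) (t<N ∷ ts<N) N≤k =
  ++⁺ (All.map (below-mono (refine-next-≥ (k + 4) ts) _)
               (SubdivisionShape.bounded (below-mono N≤k (a , b , c) t<N)))
      (refine-bounded (k + 4) ts ts<N (≤-trans N≤k (m≤m+n k 4)))

refine-distinct : ∀ {N} k ts → All (CornersBelow N) ts → N ≤ k → All Distinct (refined k ts)
refine-distinct k [] [] _ = []
refine-distinct k ((a , b , c) ∷ ts) (t<N ∷ ts<N) N≤k =
  ++⁺ (SubdivisionShape.distinct (below-mono N≤k (a , b , c) t<N))
      (refine-distinct (k + 4) ts ts<N (≤-trans N≤k (m≤m+n k 4)))

deg-absent : ∀ {N v} ts → All (CornersBelow N) ts → N ≤ v → deg v ts ≡ 0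
deg-absent [] [] _ = refl
deg-absent {N} {v} ((a , b , c) ∷ ts) ((a<N , b<N , c<N) ∷ ts<N) N≤v
  rewrite beyond⇒≡ᵇ-false a<N N≤v | beyond⇒≡ᵇ-false b<N N≤v | beyond⇒≡ᵇ-false c<N N≤v =
  deg-absent ts ts<N N≤v

refine-deg-old : ∀ {v} k ts → v < k → All Distinct ts → deg v (refined k ts) ≡ 2 * deg v ts
refine-deg-old k [] _ [] = refl
refine-deg-old {v} k ((a , b , c) ∷ ts) v<k (abc ∷ distinct) = begin
  deg v (subdivide k (a , b , c) ++ refined (k + 4) ts)
    ≡⟨ deg-++ v (subdivide k (a , b , c)) (refined (k + 4) ts) ⟩
  deg v (subdivide k (a , b , c)) + deg v (refined (k + 4) ts)
    ≡⟨ cong₂ _+_ (subdivide-deg-old v<k abc)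
                 (refine-deg-old (k + 4) ts (<-≤-trans v<k (m≤m+n k 4)) distinct) ⟩
  2 * triDeg v (a , b , c) + 2 * deg v ts
    ≡⟨ *-distribˡ-+ 2 (triDeg v (a , b , c)) (deg v ts) ⟨
  2 * deg v ((a , b , c) ∷ ts) ∎

applyUpTo-cong< : ∀ {A : Set} {f g : ℕ → A} n → (∀ i → i < n → f i ≡ g i) →
  applyUpTo f n ≡ applyUpTo g n
applyUpTo-cong< zero    eq = refl
applyUpTo-cong< (suc n) eq =
  cong₂ _∷_ (eq 0 (s≤s z≤n)) (applyUpTo-cong< n (λ i i<n → eq (suc i) (s≤s i<n)))

newDegrees : List ℕ
newDegrees = 4 ∷ 4 ∷ 4 ∷ 12 ∷ []

refine-deg-fresh : ∀ {N} k ts → All (CornersBelow N) ts → All Distinct ts → N ≤ k →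
  applyUpTo (λ i → deg (k + i) (refined k ts)) (length ts * 4)
    ≡ concat (replicate (length ts) newDegrees)
refine-deg-fresh k [] _ _ _ = refl
refine-deg-fresh {N} k ((a , b , c) ∷ ts) (t<N ∷ ts<N) (_ ∷ distinct) N≤k =
  cong₂ _++_ (applyUpTo-cong< 4 own-block)
             (trans (applyUpTo-cong< (length ts * 4) (λ i _ → later i))
                    (refine-deg-fresh (k + 4) ts ts<N distinct (≤-trans N≤k (m≤m+n k 4))))
  where
  split : ∀ i → deg (k + i) (refined k ((a , b , c) ∷ ts))
                ≡ newVertexDeg i + deg (k + i) (refined (k + 4) ts)
  split i = trans (deg-++ (k + i) (subdivide k (a , b , c)) (refined (k + 4) ts))
                  (cong (_+ deg (k + i) (refined (k + 4) ts))
                        (subdivide-deg-fresh (below-mono N≤k (a , b , c) t<N) i))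
  -- the vertices of the first triangle are old, hence isolated, for the rest
  own-block : ∀ i → i < 4 → deg (k + i) (refined k ((a , b , c) ∷ ts)) ≡ newVertexDeg i
  own-block i i<4 = begin
    deg (k + i) (refined k ((a , b , c) ∷ ts))          ≡⟨ split i ⟩
    newVertexDeg i + deg (k + i) (refined (k + 4) ts)
      ≡⟨ cong (λ d → newVertexDeg i + d) (refine-deg-old (k + 4) ts (+-monoʳ-< k i<4) distinct) ⟩
    newVertexDeg i + 2 * deg (k + i) ts
      ≡⟨ cong (λ d → newVertexDeg i + 2 * d) (deg-absent ts ts<N (≤-trans N≤k (m≤m+n k i))) ⟩
    newVertexDeg i + 0                                   ≡⟨ +-identityʳ (newVertexDeg i) ⟩
    newVertexDeg i ∎
  later : ∀ i → deg (k + (4 + i)) (refined k ((a , b , c) ∷ ts)) ≡ deg (k + 4 + i) (refined (k + 4) ts)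
  later i = trans (split (4 + i)) (cong (λ v → deg v (refined (k + 4) ts)) (sym (+-assoc k 4 i)))

triCount : ℕ → ℕ
triCount n = length (tris n)

numVertices-step : ∀ n → numVertices (suc n) ≡ numVertices n + triCount n * 4
numVertices-step n = refine-next (numVertices n) (tris n)

triCount≡6^ : ∀ n → triCount n ≡ 6 ^ n
triCount≡6^ zero    = refl
triCount≡6^ (suc n) = begin
  length (refined (numVertices n) (tris n)) ≡⟨ refine-length (numVertices n) (tris n) ⟩
  triCount n * 6                            ≡⟨ cong (_* 6) (triCount≡6^ n) ⟩
  6 ^ n * 6                                 ≡⟨ *-comm (6 ^ n) 6 ⟩
  6 ^ suc n ∎

wellFormed : ∀ n → All (CornersBelow (numVertices n)) (tris n) × All Distinct (tris n)
wellFormed zero = ((s≤s z≤n , s≤s (s≤s z≤n) , s≤s (s≤s (s≤s z≤n))) ∷ [])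
                , (((λ ()) , (λ ()) , (λ ())) ∷ [])
wellFormed (suc n) = refine-bounded (numVertices n) (tris n) below ≤-refl
                   , refine-distinct (numVertices n) (tris n) below ≤-refl
  where
  below : All (CornersBelow (numVertices n)) (tris n)
  below = proj₁ (wellFormed n)

degSeq : ℕ → List ℕ
degSeq n = applyUpTo (λ v → deg v (tris n)) (numVertices n)

degrees≡degSeq : ∀ n → map (degree n) (vertices n) ≡ degSeq n
degrees≡degSeq n = trans (map-upTo (degree n) (numVertices n))
                         (applyUpTo-cong< (numVertices n) (λ v _ → degree≡deg n v))

applyUpTo-++ : ∀ {A : Set} (f : ℕ → A) m n →
  applyUpTo f (m + n) ≡ applyUpTo f m ++ applyUpTo (λ i → f (m + i)) n
applyUpTo-++ f zero    n = refl
applyUpTo-++ f (suc m) n = cong (f 0 ∷_) (applyUpTo-++ (λ i → f (suc i)) m n)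

degSeq-step : ∀ n → degSeq (suc n) ≡ map (2 *_) (degSeq n) ++ concat (replicate (triCount n) newDegrees)
degSeq-step n = begin
  applyUpTo deg' (numVertices (suc n))      ≡⟨ cong (applyUpTo deg') (numVertices-step n) ⟩
  applyUpTo deg' (N + triCount n * 4)       ≡⟨ applyUpTo-++ deg' N (triCount n * 4) ⟩
  applyUpTo deg' N ++ applyUpTo (λ i → deg' (N + i)) (triCount n * 4)
    ≡⟨ cong₂ _++_ old (refine-deg-fresh N (tris n) below distinct ≤-refl) ⟩
  map (2 *_) (degSeq n) ++ concat (replicate (triCount n) newDegrees) ∎
  where
  N : ℕ
  N = numVertices n
  deg' : ℕ → ℕ
  deg' v = deg v (tris (suc n))
  below : All (CornersBelow N) (tris n)
  below = proj₁ (wellFormed n)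
  distinct : All Distinct (tris n)
  distinct = proj₂ (wellFormed n)
  old : applyUpTo deg' N ≡ map (2 *_) (degSeq n)
  old = trans (applyUpTo-cong< N (λ v v<N → refine-deg-old N (tris n) v<N distinct))
              (sym (map-applyUpTo (λ v → deg v (tris n)) (2 *_) N))

product-double : ∀ xs → product (map (2 *_) xs) ≡ 2 ^ length xs * product xs
product-double []       = refl
product-double (x ∷ xs) = begin
  2 * x * product (map (2 *_) xs)        ≡⟨ cong (2 * x *_) (product-double xs) ⟩
  2 * x * (2 ^ length xs * product xs)   ≡⟨ swap-middle x (2 ^ length xs) (product xs) ⟩
  2 * 2 ^ length xs * (x * product xs)   ∎
  where
  swap-middle : ∀ x y z → 2 * x * (y * z) ≡ 2 * y * (x * z)
  swap-middle = ℕ-Ring.solve-∀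

sum-double : ∀ xs → sum (map (2 *_) xs) ≡ 2 * sum xs
sum-double []       = refl
sum-double (x ∷ xs) = trans (cong (λ s → 2 * x + s) (sum-double xs)) (sym (*-distribˡ-+ 2 x (sum xs)))

product-replicate : ∀ m xs → product (concat (replicate m xs)) ≡ product xs ^ m
product-replicate zero    xs = refl
product-replicate (suc m) xs =
  trans (product-++ xs (concat (replicate m xs))) (cong (product xs *_) (product-replicate m xs))

sum-replicate : ∀ m xs → sum (concat (replicate m xs)) ≡ m * sum xs
sum-replicate zero    xs = refl
sum-replicate (suc m) xs =
  trans (sum-++ xs (concat (replicate m xs))) (cong (λ s → sum xs + s) (sum-replicate m xs))

P S : ℕ → ℕ
P n = product (degSeq n)
S n = sum (degSeq n)

P-step : ∀ n → P (suc n) ≡ 2 ^ numVertices n * P n * 768 ^ triCount n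
P-step n = begin
  product (degSeq (suc n))                                  ≡⟨ cong product (degSeq-step n) ⟩
  product (map (2 *_) (degSeq n) ++ blocks)                 ≡⟨ product-++ (map (2 *_) (degSeq n)) blocks ⟩
  product (map (2 *_) (degSeq n)) * product blocks
    ≡⟨ cong₂ _*_ (product-double (degSeq n)) (product-replicate (triCount n) newDegrees) ⟩
  2 ^ length (degSeq n) * P n * 768 ^ triCount n
    ≡⟨ cong (λ l → 2 ^ l * P n * 768 ^ triCount n) (length-applyUpTo _ (numVertices n)) ⟩
  2 ^ numVertices n * P n * 768 ^ triCount n ∎
  where
  blocks : List ℕ
  blocks = concat (replicate (triCount n) newDegrees)

S-step : ∀ n → S (suc n) ≡ 2 * S n + triCount n * 24
S-step n = begin
  sum (degSeq (suc n))                                      ≡⟨ cong sum (degSeq-step n) ⟩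
  sum (map (2 *_) (degSeq n) ++ blocks)                     ≡⟨ sum-++ (map (2 *_) (degSeq n)) blocks ⟩
  sum (map (2 *_) (degSeq n)) + sum blocks
    ≡⟨ cong₂ _+_ (sum-double (degSeq n)) (sum-replicate (triCount n) newDegrees) ⟩
  2 * S n + triCount n * 24 ∎
  where
  blocks : List ℕ
  blocks = concat (replicate (triCount n) newDegrees)

-- Σ degrees = twice the number of edges = 6 · 6ⁿ.
S-closed : ∀ n → S n ≡ 6 * 6 ^ n
S-closed zero    = refl
S-closed (suc n) = begin
  S (suc n)                    ≡⟨ S-step n ⟩
  2 * S n + triCount n * 24    ≡⟨ cong₂ (λ s t → 2 * s + t * 24) (S-closed n) (triCount≡6^ n) ⟩
  2 * (6 * 6 ^ n) + 6 ^ n * 24 ≡⟨ collect (6 ^ n) ⟩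
  6 * 6 ^ suc n ∎
  where
  collect : ∀ x → 2 * (6 * x) + x * 24 ≡ 6 * (6 * x)
  collect = ℕ-Ring.solve-∀

-- pred6^ n = 6ⁿ − 1, defined without truncated subtraction.
pred6^ : ℕ → ℕ
pred6^ zero    = 0
pred6^ (suc n) = 5 + pred6^ n * 6

6^≡suc-pred6^ : ∀ n → 6 ^ n ≡ suc (pred6^ n)
6^≡suc-pred6^ zero    = refl
6^≡suc-pred6^ (suc n) = trans (cong (6 *_) (6^≡suc-pred6^ n)) (expand (pred6^ n))
  where
  expand : ∀ x → 6 * suc x ≡ suc (5 + x * 6)
  expand = ℕ-Ring.solve-∀

triCount≡suc-pred6^ : ∀ n → triCount n ≡ suc (pred6^ n)
triCount≡suc-pred6^ n = trans (triCount≡6^ n) (6^≡suc-pred6^ n)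

vertexCount : ∀ n → 5 * numVertices n ≡ 4 * 6 ^ n + 11
vertexCount zero    = refl
vertexCount (suc n) = begin
  5 * numVertices (suc n)                  ≡⟨ cong (5 *_) (numVertices-step n) ⟩
  5 * (numVertices n + triCount n * 4)     ≡⟨ *-distribˡ-+ 5 (numVertices n) (triCount n * 4) ⟩
  5 * numVertices n + 5 * (triCount n * 4)
    ≡⟨ cong₂ (λ a t → a + 5 * (t * 4)) (vertexCount n) (triCount≡6^ n) ⟩
  4 * 6 ^ n + 11 + 5 * (6 ^ n * 4)         ≡⟨ collect (6 ^ n) ⟩
  4 * 6 ^ suc n + 11 ∎
  where
  collect : ∀ x → 4 * x + 11 + 5 * (x * 4) ≡ 4 * (6 * x) + 11
  collect = ℕ-Ring.solve-∀

-- Exponents of 2 and 3 in the integer 3 · P n / S n.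
twoExp : ℕ → ℕ
twoExp zero    = 2
twoExp (suc n) = numVertices n + (7 + (8 * pred6^ n + twoExp n))

threeExp : ℕ → ℕ
threeExp zero    = 0
threeExp (suc n) = pred6^ n + threeExp n

*-^-distrib : ∀ a b m → (a * b) ^ m ≡ a ^ m * b ^ m
*-^-distrib a b zero    = refl
*-^-distrib a b (suc m) = trans (cong (a * b *_) (*-^-distrib a b m)) (interchange a b (a ^ m) (b ^ m))
  where
  interchange : ∀ a b x y → a * b * (x * y) ≡ a * x * (b * y)
  interchange = ℕ-Ring.solve-∀

-- 768 = 2⁸ · 3 is the product of one block 4 4 4 12.
768^ : ∀ m → 768 ^ m ≡ 2 ^ (8 * m) * 3 ^ m
768^ m = trans (*-^-distrib 256 3 m) (cong (_* 3 ^ m) (^-*-assoc 2 8 m))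

-- Every subdivision multiplies P by 2^|V_n| · 768^(6ⁿ) and S by 6, and
-- 768 = 6 · 2⁷; the exponents absorb the remaining powers.
quotient-identity : ∀ n → 3 * P n ≡ S n * (2 ^ twoExp n * 3 ^ threeExp n)
quotient-identity zero    = refl
quotient-identity (suc n) = begin
  3 * P (suc n)                              ≡⟨ cong (3 *_) (P-step n) ⟩
  3 * (X * P n * 768 ^ triCount n)           ≡⟨ cong (λ t → 3 * (X * P n * 768 ^ t)) (triCount≡suc-pred6^ n) ⟩
  3 * (X * P n * (768 * 768 ^ q))            ≡⟨ cong (λ t → 3 * (X * P n * (768 * t))) (768^ q) ⟩
  3 * (X * P n * (768 * (Y * Z)))            ≡⟨ regroup X (P n) Y Z ⟩
  X * (768 * (Y * Z)) * (3 * P n)            ≡⟨ cong (X * (768 * (Y * Z)) *_) (quotient-identity n) ⟩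
  X * (768 * (Y * Z)) * (S n * (U * W))      ≡⟨ collect X Y Z (S n) U W ⟩
  6 * S n * (X * (128 * (Y * U)) * (Z * W))  ≡⟨ cong₂ _*_ (sym S-six) (sym (cong₂ _*_ two-split three-split)) ⟩
  S (suc n) * (2 ^ twoExp (suc n) * 3 ^ threeExp (suc n)) ∎
  where
  q X Y Z U W : ℕ
  q = pred6^ n
  X = 2 ^ numVertices n
  Y = 2 ^ (8 * q)
  Z = 3 ^ q
  U = 2 ^ twoExp n
  W = 3 ^ threeExp n
  regroup : ∀ X P Y Z → 3 * (X * P * (768 * (Y * Z))) ≡ X * (768 * (Y * Z)) * (3 * P)
  regroup = ℕ-Ring.solve-∀
  collect : ∀ X Y Z S U W → X * (768 * (Y * Z)) * (S * (U * W)) ≡ 6 * S * (X * (128 * (Y * U)) * (Z * W))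
  collect = ℕ-Ring.solve-∀
  S-six : S (suc n) ≡ 6 * S n
  S-six = trans (S-closed (suc n)) (cong (6 *_) (sym (S-closed n)))
  two-split : 2 ^ twoExp (suc n) ≡ X * (128 * (Y * U))
  two-split = begin
    2 ^ (numVertices n + (7 + (8 * q + twoExp n)))  ≡⟨ ^-distribˡ-+-* 2 (numVertices n) (7 + (8 * q + twoExp n)) ⟩
    X * 2 ^ (7 + (8 * q + twoExp n))                ≡⟨ cong (X *_) (^-distribˡ-+-* 2 7 (8 * q + twoExp n)) ⟩
    X * (128 * 2 ^ (8 * q + twoExp n))              ≡⟨ cong (λ t → X * (128 * t)) (^-distribˡ-+-* 2 (8 * q) (twoExp n)) ⟩
    X * (128 * (Y * U)) ∎
  three-split : 3 ^ threeExp (suc n) ≡ Z * W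
  three-split = ^-distribˡ-+-* 3 q (threeExp n)

twoExp-closed : ∀ n → 25 * twoExp n ≡ 44 * 6 ^ n + 30 * n + 6
twoExp-closed zero    = refl
twoExp-closed (suc n) = begin
  25 * (numVertices n + (7 + (8 * q + twoExp n)))
    ≡⟨ expand (numVertices n) q (twoExp n) ⟩
  5 * (5 * numVertices n) + 200 * q + 175 + 25 * twoExp n
    ≡⟨ cong₂ (λ v e → 5 * v + 200 * q + 175 + e) (vertexCount n) (twoExp-closed n) ⟩
  5 * (4 * 6 ^ n + 11) + 200 * q + 175 + (44 * 6 ^ n + 30 * n + 6)
    ≡⟨ cong (λ x → 5 * (4 * x + 11) + 200 * q + 175 + (44 * x + 30 * n + 6)) (6^≡suc-pred6^ n) ⟩
  5 * (4 * suc q + 11) + 200 * q + 175 + (44 * suc q + 30 * n + 6)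
    ≡⟨ collect q n ⟩
  44 * (6 * suc q) + 30 * suc n + 6
    ≡⟨ cong (λ x → 44 * (6 * x) + 30 * suc n + 6) (6^≡suc-pred6^ n) ⟨
  44 * 6 ^ suc n + 30 * suc n + 6 ∎
  where
  q : ℕ
  q = pred6^ n
  expand : ∀ v q e → 25 * (v + (7 + (8 * q + e))) ≡ 5 * (5 * v) + 200 * q + 175 + 25 * e
  expand = ℕ-Ring.solve-∀
  collect : ∀ q n → 5 * (4 * suc q + 11) + 200 * q + 175 + (44 * suc q + 30 * n + 6)
                    ≡ 44 * (6 * suc q) + 30 * suc n + 6
  collect = ℕ-Ring.solve-∀

threeExp-closed : ∀ n → 5 * threeExp n + 5 * n ≡ pred6^ n
threeExp-closed zero    = refl
threeExp-closed (suc n) = begin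
  5 * (q + threeExp n) + 5 * suc n     ≡⟨ expand q (threeExp n) n ⟩
  5 * q + (5 * threeExp n + 5 * n) + 5 ≡⟨ cong (λ t → 5 * q + t + 5) (threeExp-closed n) ⟩
  5 * q + q + 5                        ≡⟨ collect q ⟩
  5 + q * 6 ∎
  where
  q : ℕ
  q = pred6^ n
  expand : ∀ q b n → 5 * (q + b) + 5 * suc n ≡ 5 * q + (5 * b + 5 * n) + 5
  expand = ℕ-Ring.solve-∀
  collect : ∀ q → 5 * q + q + 5 ≡ 5 + q * 6
  collect = ℕ-Ring.solve-∀

ratio-ℕ : ∀ n c → threeExp n ≡ suc c → P n ≡ S n * (2 ^ twoExp n * 3 ^ c)
ratio-ℕ n c eq = *-cancelˡ-≡ (P n) (S n * (2 ^ twoExp n * 3 ^ c)) 3 (begin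
  3 * P n                                   ≡⟨ quotient-identity n ⟩
  S n * (2 ^ twoExp n * 3 ^ threeExp n)     ≡⟨ cong (λ e → S n * (2 ^ twoExp n * 3 ^ e)) eq ⟩
  S n * (2 ^ twoExp n * (3 * 3 ^ c))        ≡⟨ pull-three (S n) (2 ^ twoExp n) (3 ^ c) ⟩
  3 * (S n * (2 ^ twoExp n * 3 ^ c)) ∎)
  where
  pull-three : ∀ s u w → s * (u * (3 * w)) ≡ 3 * (s * (u * w))
  pull-three = ℕ-Ring.solve-∀

sixPow-affine : ∀ n c → threeExp n ≡ suc c → 6 ^ n ≡ 5 * c + 5 * n + 6
sixPow-affine n c eq = begin
  6 ^ n                              ≡⟨ 6^≡suc-pred6^ n ⟩
  suc (pred6^ n)                     ≡⟨ cong suc (threeExp-closed n) ⟨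
  suc (5 * threeExp n + 5 * n)       ≡⟨ cong (λ e → suc (5 * e + 5 * n)) eq ⟩
  suc (5 * suc c + 5 * n)            ≡⟨ collect c n ⟩
  5 * c + 5 * n + 6 ∎
  where
  collect : ∀ c n → suc (5 * suc c + 5 * n) ≡ 5 * c + 5 * n + 6
  collect = ℕ-Ring.solve-∀

cast-affine : ∀ a x b y c → + (a * x + b * y + c) ≡ + a ℤ.* + x ℤ.+ + b ℤ.* + y ℤ.+ + c
cast-affine a x b y c = begin
  + (a * x + b * y + c)            ≡⟨ pos-+ (a * x + b * y) c ⟩
  + (a * x + b * y) ℤ.+ + c        ≡⟨ cong (ℤ._+ + c) (pos-+ (a * x) (b * y)) ⟩
  + (a * x) ℤ.+ + (b * y) ℤ.+ + c  ≡⟨ cong₂ (λ u w → u ℤ.+ w ℤ.+ + c) (pos-* a x) (pos-* b y) ⟩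
  + a ℤ.* + x ℤ.+ + b ℤ.* + y ℤ.+ + c ∎

over1-* : ∀ a b → (+ a / 1) ℚ.* (+ b / 1) ≡ + (a * b) / 1
over1-* a b = trans (cong₂ ℚ._*_ (normalize-coprime (over1 a)) (normalize-coprime (over1 b)))
                    (cong (_/ 1) (sym (pos-* a b)))
  where
  over1 : ∀ m → Coprime m 1
  over1 m = Coprimality.sym (1-coprimeTo m)

twoExp-ℤ : ∀ n → + 25 ℤ.* + twoExp n ≡ + 44 ℤ.* + (6 ^ n) ℤ.+ + 30 ℤ.* + n ℤ.+ + 6
twoExp-ℤ n = begin
  + 25 ℤ.* + twoExp n             ≡⟨ pos-* 25 (twoExp n) ⟨
  + (25 * twoExp n)               ≡⟨ cong +_ (twoExp-closed n) ⟩
  + (44 * 6 ^ n + 30 * n + 6)     ≡⟨ cast-affine 44 (6 ^ n) 30 n 6 ⟩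
  + 44 ℤ.* + (6 ^ n) ℤ.+ + 30 ℤ.* + n ℤ.+ + 6 ∎

threeExp-ℤ : ∀ n c → threeExp n ≡ suc c → + 5 ℤ.* + c ≡ + (6 ^ n) - + 5 ℤ.* + n - + 6
threeExp-ℤ n c eq = begin
  + 5 ℤ.* + c                                             ≡⟨ cancel (+ 5 ℤ.* + c) (+ 5 ℤ.* + n) (+ 6) ⟩
  + 5 ℤ.* + c ℤ.+ + 5 ℤ.* + n ℤ.+ + 6 - + 5 ℤ.* + n - + 6 ≡⟨ cong (λ t → t - + 5 ℤ.* + n - + 6) sixPow ⟨
  + (6 ^ n) - + 5 ℤ.* + n - + 6 ∎
  where
  sixPow : + (6 ^ n) ≡ + 5 ℤ.* + c ℤ.+ + 5 ℤ.* + n ℤ.+ + 6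
  sixPow = trans (cong +_ (sixPow-affine n c eq)) (cast-affine 5 c 5 n 6)
  cancel : ∀ (x y z : ℤ) → x ≡ x ℤ.+ y ℤ.+ z - y - z
  cancel = ℤ-Ring.solve-∀

degree-ratio : ∀ n c → threeExp n ≡ suc c →
  (+ degProduct n) / 1 ≡ ((+ degSum n) / 1) ℚ.* (pow2ℤ (+ twoExp n) ℚ.* pow3ℤ (+ c))
degree-ratio n c eq = sym (begin
  (+ degSum n / 1) ℚ.* ((+ (2 ^ twoExp n) / 1) ℚ.* (+ (3 ^ c) / 1))
    ≡⟨ cong ((+ degSum n / 1) ℚ.*_) (over1-* (2 ^ twoExp n) (3 ^ c)) ⟩
  (+ degSum n / 1) ℚ.* (+ (2 ^ twoExp n * 3 ^ c) / 1)
    ≡⟨ over1-* (degSum n) (2 ^ twoExp n * 3 ^ c) ⟩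
  + (degSum n * (2 ^ twoExp n * 3 ^ c)) / 1
    ≡⟨ cong (λ k → + (k * (2 ^ twoExp n * 3 ^ c)) / 1) (cong sum (degrees≡degSeq n)) ⟩
  + (S n * (2 ^ twoExp n * 3 ^ c)) / 1
    ≡⟨ cong (λ k → + k / 1) (ratio-ℕ n c eq) ⟨
  + P n / 1
    ≡⟨ cong (λ k → + k / 1) (cong product (degrees≡degSeq n)) ⟨
  + degProduct n / 1 ∎)

corollary5p5 : (n : ℕ) → n ≥ 1 →
    Σ ℤ λ e₂ → Σ ℤ λ e₃ →
      (+ 25 ℤ.* e₂ ≡ + 44 ℤ.* + (6 ^ n) ℤ.+ + 30 ℤ.* + n ℤ.+ + 6)
      × (+ 5 ℤ.* e₃ ≡ + (6 ^ n) - + 5 ℤ.* + n - + 6)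
      × ((+ degProduct n) / 1 ≡ ((+ degSum n) / 1) ℚ.* (pow2ℤ e₂ ℚ.* pow3ℤ e₃))
-- n = 1: P/S = 2¹² · 3⁻¹, checked by evaluation.
corollary5p5 (suc zero) _ = + 12 , ℤ.-[1+ 0 ] , refl , refl , refl
-- n ≥ 2: threeExp n is positive (it starts with pred6^ (n − 1) ≥ 5), so e₃ = threeExp n − 1 ≥ 0.
corollary5p5 n@(suc (suc m)) _ =
  + twoExp n , + c , twoExp-ℤ n , threeExp-ℤ n c threeExp≡suc-c , degree-ratio n c threeExp≡suc-c
  where
  c : ℕ
  c = pred (threeExp n)
  threeExp≡suc-c : threeExp n ≡ suc c
  threeExp≡suc-c = refl
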